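{- Let $A=\{a_1,a_2,a_3,a_4,a_5\}$ be a set of positive integers with $a_1<a_2<a_3<a_4<a_5$, such that $a_4-a_3=a_2-a_1$, $a_5-a_3\ne 2a_1$, and $a_i-a_{i-1}\ne 2a_1$ for all $i\in\{2,3,4,5\}$. Then $\left|4^{\wedge}_{\pm}A\right|\ge 26$.
   Context: For a positive integer $h$ and a finite set of integers $A=\{a_1,\ldots,a_k\}$ (distinct elements), the restricted $h$-fold signed sumset is $h^{\wedge}_{\pm}A=\left\{\sum_{i=1}^k\lambda_i a_i:\lambda_i\in\{ -1,0,1\},\ \sum_{i=1}^k|\lambda_i|=h\right\}$. -}

module Defs where

open import Data.Nat using (ℕ; zero; suc)
open import Data.Integer using (ℤ; _+_; -_; +_)
open import Data.Integer.Properties using (_≟_)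
open import Data.List using (List; []; _∷_; _++_; map; length; deduplicate)

-- restrictedSignedSums h as : the list (with repetitions) of all sums
-- Σ λᵢ aᵢ with λᵢ ∈ {-1,0,1} and Σ |λᵢ| = h, where as = [a₁,…,a_k].
restrictedSignedSums : ℕ → List ℤ → List ℤ
restrictedSignedSums zero    []       = + 0 ∷ []
restrictedSignedSums (suc h) []       = []
restrictedSignedSums zero    (a ∷ as) = restrictedSignedSums zero as
restrictedSignedSums (suc h) (a ∷ as) =
  restrictedSignedSums (suc h) as
  ++ map (λ s → a + s) (restrictedSignedSums h as)
  ++ map (λ s → (- a) + s) (restrictedSignedSums h as)

signedSumsetSize : ℕ → List ℤ → ℕ
signedSumsetSize h as = length (deduplicate _≟_ (restrictedSignedSums h as))

-- Write a₄ = a₂ + a₃ − a₁, d = a₂ − a₁. In each of the cases d > 2a₁ and d < 2a₁ there are thirteen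
-- signed sums of four elements of A (all with +a₅) forming a chain 0 < s₀ < s₁ < ⋯ < s₁₂ whose
-- steps are among a₅ − a₄, d, a₃ − a₂, 2a₁ and |d − 2a₁|, hence positive. Together with their
-- negatives they give 26 distinct elements of 4^∧_± A. Every step is an identity between integer
-- linear forms in (a₁, a₂, a₃, a₅), so it is verified by evaluating the forms.
module Submission where

open import Defs
open import Data.Nat using (ℕ; _≤_)
open import Data.Integer using (ℤ; _+_; _-_; _*_; _<_; +_)
open import Data.List using (List; []; _∷_)
open import Relation.Binary.PropositionalEquality using (_≡_; _≢_)

open import Level using (0ℓ)
open import Algebra.Bundles.Raw using (RawGroup)
open import Data.Nat as ℕ using (zero; suc; z≤n; s≤s)
open import Data.Nat.Properties using (module ≤-Reasoning)
open import Data.Integer using (0ℤ; -_; +-0-rawGroup)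
open import Data.Integer.Properties
  using (_≟_; *-identityˡ; +-identityˡ; +-identityʳ; +-inverseʳ; +-monoˡ-<; +-mono-<; <-trans; <-cmp; <⇒≢;
         neg-involutive; neg-distrib-+; neg-injective; neg-mono-<; <-asym)
open import Data.Integer.Tactic.RingSolver using (solve-∀)
open import Data.Fin as Fin using (Fin; #_)
open import Data.Vec as Vec using (Vec; []; _∷_; toList; replicate; zipWith; lookup)
open import Data.List using (map; length; _++_; deduplicate)
open import Data.List.Properties using (map-cong; map-∘; length-++; length-map; length-removeAt′)
open import Data.List.Membership.Propositional using (_∈_; _─_)
open import Data.List.Membership.Propositional.Properties
  using (∈-++⁺ˡ; ∈-++⁺ʳ; ∈-++⁻; ∈-map⁺; ∈-map⁻; ∈-deduplicate⁺)
open import Data.List.Relation.Binary.Subset.Propositional using (_⊆_)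
open import Data.List.Relation.Binary.Disjoint.Propositional using (Disjoint)
open import Data.List.Relation.Unary.Any using (here; there; index)
open import Data.List.Relation.Unary.All as All using (All; []; _∷_)
open import Data.List.Relation.Unary.AllPairs as AllPairs using (AllPairs; []; _∷_)
open import Data.List.Relation.Unary.Linked using (Linked; []; [-]; _∷_)
open import Data.List.Relation.Unary.Linked.Properties using (Linked⇒AllPairs)
open import Data.List.Relation.Unary.Unique.Propositional using (Unique)
import Data.List.Relation.Unary.Unique.Propositional.Properties as Unique
open import Data.Empty using (⊥-elim)
open import Data.Product using (_,_)
open import Data.Sum using ([_,_])
open import Function using (_∘_)
open import Relation.Binary.PropositionalEquality
  using (refl; sym; trans; cong; cong₂; subst; subst₂)
open import Relation.Binary.Definitions using (Tri; tri<; tri≈; tri>)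

private
  variable
    h k n : ℕ

-- SignVector h k encodes the coefficient vectors (λ₁,…,λ_k) ∈ {-1,0,1}ᵏ with Σ|λᵢ| = h.
data SignVector : ℕ → ℕ → Set where
  []  : SignVector 0 0
  0∷_ : SignVector h k → SignVector h (suc k)
  +∷_ : SignVector h k → SignVector (suc h) (suc k)
  -∷_ : SignVector h k → SignVector (suc h) (suc k)

infixr 5 0∷_ +∷_ -∷_

negate : SignVector h k → SignVector h k
negate []     = []
negate (0∷ σ) = 0∷ negate σ
negate (+∷ σ) = -∷ negate σ
negate (-∷ σ) = +∷ negate σ

module _ (G : RawGroup 0ℓ 0ℓ) where
  open RawGroup G

  signedSum : SignVector h k → Vec Carrier k → Carrier
  signedSum []     []       = ε
  signedSum (0∷ σ) (x ∷ xs) = signedSum σ xs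
  signedSum (+∷ σ) (x ∷ xs) = x ∙ signedSum σ xs
  signedSum (-∷ σ) (x ∷ xs) = x ⁻¹ ∙ signedSum σ xs

module _ (G H : RawGroup 0ℓ 0ℓ) (f : RawGroup.Carrier G → RawGroup.Carrier H) where
  private
    module G = RawGroup G
    module H = RawGroup H

  signedSum-homo : (∀ x y → f (x G.∙ y) ≡ f x H.∙ f y) → (∀ x → f (x G.⁻¹) ≡ f x H.⁻¹) →
                   f G.ε ≡ H.ε →
                   (σ : SignVector h k) (xs : Vec G.Carrier k) →
                   f (signedSum G σ xs) ≡ signedSum H σ (Vec.map f xs)
  signedSum-homo ∙-homo ⁻¹-homo ε-homo = go
    where
    go : (σ : SignVector h k) (xs : Vec G.Carrier k) → f (signedSum G σ xs) ≡ signedSum H σ (Vec.map f xs)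
    go []     []       = ε-homo
    go (0∷ σ) (x ∷ xs) = go σ xs
    go (+∷ σ) (x ∷ xs) = trans (∙-homo x _) (cong (f x H.∙_) (go σ xs))
    go (-∷ σ) (x ∷ xs) = trans (∙-homo (x G.⁻¹) _) (cong₂ H._∙_ (⁻¹-homo x) (go σ xs))

signedSumℤ : SignVector h k → Vec ℤ k → ℤ
signedSumℤ = signedSum +-0-rawGroup

signedSumℤ-negate : (σ : SignVector h k) (xs : Vec ℤ k) → signedSumℤ (negate σ) xs ≡ - signedSumℤ σ xs
signedSumℤ-negate []     []       = refl
signedSumℤ-negate (0∷ σ) (x ∷ xs) = signedSumℤ-negate σ xs
signedSumℤ-negate (+∷ σ) (x ∷ xs) =
  trans (cong (_+_ (- x)) (signedSumℤ-negate σ xs)) (sym (neg-distrib-+ x _))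
signedSumℤ-negate (-∷ σ) (x ∷ xs) =
  trans (cong₂ _+_ (sym (neg-involutive x)) (signedSumℤ-negate σ xs)) (sym (neg-distrib-+ (- x) _))

signedSumℤ-∈ : (σ : SignVector h k) (xs : Vec ℤ k) → signedSumℤ σ xs ∈ restrictedSignedSums h (toList xs)
signedSumℤ-∈             []     []       = here refl
signedSumℤ-∈ {h = zero}  (0∷ σ) (x ∷ xs) = signedSumℤ-∈ σ xs
signedSumℤ-∈ {h = suc h} (0∷ σ) (x ∷ xs) = ∈-++⁺ˡ (signedSumℤ-∈ σ xs)
signedSumℤ-∈ {h = suc h} (+∷ σ) (x ∷ xs) =
  ∈-++⁺ʳ (restrictedSignedSums (suc h) (toList xs)) (∈-++⁺ˡ (∈-map⁺ (_+_ x) (signedSumℤ-∈ σ xs)))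
signedSumℤ-∈ {h = suc h} (-∷ σ) (x ∷ xs) =
  ∈-++⁺ʳ (restrictedSignedSums (suc h) (toList xs))
    (∈-++⁺ʳ (map (_+_ x) (restrictedSignedSums h (toList xs))) (∈-map⁺ (_+_ (- x)) (signedSumℤ-∈ σ xs)))

module _ {A : Set} where

  ∈-─⁺ : {x y : A} {xs : List A} (p : x ∈ xs) → y ∈ xs → y ≢ x → y ∈ xs ─ p
  ∈-─⁺ (here refl) (here refl) y≢x = ⊥-elim (y≢x refl)
  ∈-─⁺ (here _)    (there q)   _   = q
  ∈-─⁺ (there p)   (here refl) _   = here refl
  ∈-─⁺ (there p)   (there q)   y≢x = there (∈-─⁺ p q y≢x)

  Unique-⊆⇒length≤ : {xs ys : List A} → Unique xs → xs ⊆ ys → length xs ≤ length ys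
  Unique-⊆⇒length≤ {[]}     _              _    = z≤n
  Unique-⊆⇒length≤ {x ∷ xs} {ys} (x∉xs ∷ u) xs⊆ys =
    subst (length (x ∷ xs) ≤_) (sym (length-removeAt′ ys (index x∈ys))) (s≤s (Unique-⊆⇒length≤ u xs⊆ys─x))
    where
    x∈ys : x ∈ ys
    x∈ys = xs⊆ys (here refl)
    xs⊆ys─x : xs ⊆ ys ─ x∈ys
    xs⊆ys─x y∈xs = ∈-─⁺ x∈ys (xs⊆ys (there y∈xs)) (λ y≡x → All.lookup x∉xs y∈xs (sym y≡x))

signedSums-⊆ : (xs : Vec ℤ k) (τs : List (SignVector h k)) →
               map (λ τ → signedSumℤ τ xs) τs ⊆ deduplicate _≟_ (restrictedSignedSums h (toList xs))
signedSums-⊆ xs τs v∈ with ∈-map⁻ (λ τ → signedSumℤ τ xs) v∈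
... | τ , _ , refl = ∈-deduplicate⁺ _≟_ (signedSumℤ-∈ τ xs)

positiveChain⇒signedSumsetSize≥ : (xs : Vec ℤ k) (σs : List (SignVector h k)) →
  Linked _<_ (0ℤ ∷ map (λ σ → signedSumℤ σ xs) σs) →
  length σs ℕ.+ length σs ≤ signedSumsetSize h (toList xs)
positiveChain⇒signedSumsetSize≥ {h = h} xs σs chain = begin
  length σs ℕ.+ length σs       ≡⟨ sym lengths ⟩
  length (negatives ++ values)  ≤⟨ Unique-⊆⇒length≤ unique subset ⟩
  signedSumsetSize h (toList xs) ∎
  where
  open ≤-Reasoning
  sum : SignVector h _ → ℤ
  sum σ = signedSumℤ σ xs
  values negatives : List ℤ
  values    = map sum σs
  negatives = map sum (map negate σs)

  sorted : AllPairs _<_ (0ℤ ∷ values)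
  sorted = Linked⇒AllPairs <-trans chain

  positive : All (0ℤ <_) values
  positive = AllPairs.head sorted

  negatives≡ : negatives ≡ map (-_) values
  negatives≡ = trans (sym (map-∘ σs)) (trans (map-cong (λ σ → signedSumℤ-negate σ xs) σs) (map-∘ σs))

  disjoint : Disjoint (map (-_) values) values
  disjoint (-w∈ , v∈) with ∈-map⁻ (-_) -w∈
  ... | w , w∈ , refl = <-asym (All.lookup positive v∈) (neg-mono-< (All.lookup positive w∈))

  unique : Unique (negatives ++ values)
  unique = subst (λ ns → Unique (ns ++ values)) (sym negatives≡)
    (Unique.++⁺ (Unique.map⁺ neg-injective increasing) increasing disjoint)
    where increasing = AllPairs.map <⇒≢ (AllPairs.tail sorted)

  subset : negatives ++ values ⊆ deduplicate _≟_ (restrictedSignedSums h (toList xs))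
  subset = [ signedSums-⊆ xs (map negate σs) , signedSums-⊆ xs σs ] ∘ ∈-++⁻ negatives

  lengths : length (negatives ++ values) ≡ length σs ℕ.+ length σs
  lengths = trans (length-++ negatives)
    (cong₂ ℕ._+_ (trans (length-map sum (map negate σs)) (length-map negate σs)) (length-map sum σs))

Form : ℕ → Set
Form = Vec ℤ

infixl 6 _⊕_ _⊖_
infix  8 ⊝_

_⊕_ : Form n → Form n → Form n
_⊕_ = zipWith _+_

⊝_ : Form n → Form n
⊝_ = Vec.map (-_)

_⊖_ : Form n → Form n → Form n
u ⊖ v = u ⊕ ⊝ v

𝟎 : Form n
𝟎 = replicate _ 0ℤ

unit : Fin n → Form n
unit Fin.zero    = + 1 ∷ 𝟎
unit (Fin.suc i) = 0ℤ ∷ unit i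

formGroup : ℕ → RawGroup 0ℓ 0ℓ
formGroup n = record { Carrier = Form n ; _≈_ = _≡_ ; _∙_ = _⊕_ ; _⁻¹ = ⊝_ ; ε = 𝟎 }

⟦_⟧ : Form n → Vec ℤ n → ℤ
⟦ []    ⟧ []       = 0ℤ
⟦ c ∷ u ⟧ (x ∷ xs) = c * x + ⟦ u ⟧ xs

⟦⟧-⊕ : (u v : Form n) (xs : Vec ℤ n) → ⟦ u ⊕ v ⟧ xs ≡ ⟦ u ⟧ xs + ⟦ v ⟧ xs
⟦⟧-⊕ []      []      []       = refl
⟦⟧-⊕ (c ∷ u) (d ∷ v) (x ∷ xs) = trans (cong (_+_ ((c + d) * x)) (⟦⟧-⊕ u v xs)) (interchange c d x _ _)
  where
  interchange : ∀ c d x p q → (c + d) * x + (p + q) ≡ (c * x + p) + (d * x + q)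
  interchange = solve-∀

⟦⟧-⊝ : (u : Form n) (xs : Vec ℤ n) → ⟦ ⊝ u ⟧ xs ≡ - ⟦ u ⟧ xs
⟦⟧-⊝ []      []       = refl
⟦⟧-⊝ (c ∷ u) (x ∷ xs) = trans (cong (_+_ (- c * x)) (⟦⟧-⊝ u xs)) (negate-out c x _)
  where
  negate-out : ∀ c x p → - c * x + - p ≡ - (c * x + p)
  negate-out = solve-∀

⟦⟧-⊖ : (u v : Form n) (xs : Vec ℤ n) → ⟦ u ⊖ v ⟧ xs ≡ ⟦ u ⟧ xs - ⟦ v ⟧ xs
⟦⟧-⊖ u v xs = trans (⟦⟧-⊕ u (⊝ v) xs) (cong (_+_ (⟦ u ⟧ xs)) (⟦⟧-⊝ v xs))

⟦⟧-𝟎 : (xs : Vec ℤ n) → ⟦ 𝟎 ⟧ xs ≡ 0ℤ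
⟦⟧-𝟎 []       = refl
⟦⟧-𝟎 (x ∷ xs) = cong (_+_ 0ℤ) (⟦⟧-𝟎 xs)

⟦⟧-unit : (i : Fin n) (xs : Vec ℤ n) → ⟦ unit i ⟧ xs ≡ lookup xs i
⟦⟧-unit Fin.zero    (x ∷ xs) = trans (cong₂ _+_ (*-identityˡ x) (⟦⟧-𝟎 xs)) (+-identityʳ x)
⟦⟧-unit (Fin.suc i) (x ∷ xs) = trans (+-identityˡ _) (⟦⟧-unit i xs)

⟦⟧-signedSum : (σ : SignVector h k) (us : Vec (Form n) k) (xs : Vec ℤ n) →
               ⟦ signedSum (formGroup n) σ us ⟧ xs ≡ signedSumℤ σ (Vec.map (λ u → ⟦ u ⟧ xs) us)
⟦⟧-signedSum {n = n} σ us xs = signedSum-homo (formGroup n) +-0-rawGroup (λ u → ⟦ u ⟧ xs)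
  (λ u v → ⟦⟧-⊕ u v xs) (λ u → ⟦⟧-⊝ u xs) (⟦⟧-𝟎 xs) σ us

differences : Form n → List (Form n) → List (Form n)
differences u []       = []
differences u (v ∷ vs) = v ⊖ u ∷ differences v vs

0<j-i⇒i<j : {i j : ℤ} → 0ℤ < j - i → i < j
0<j-i⇒i<j {i} {j} 0<j-i = subst₂ _<_ (+-identityˡ i) (minus-plus i j) (+-monoˡ-< i 0<j-i)
  where
  minus-plus : ∀ i j → j - i + i ≡ j
  minus-plus = solve-∀

i<j⇒0<j-i : {i j : ℤ} → i < j → 0ℤ < j - i
i<j⇒0<j-i {i} {j} i<j = subst (_< j - i) (+-inverseʳ i) (+-monoˡ-< (- i) i<j)

positive-differences⇒ascending : (xs : Vec ℤ n) (u : Form n) (vs : List (Form n)) →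
  All (λ g → 0ℤ < ⟦ g ⟧ xs) (differences u vs) → Linked _<_ (⟦ u ⟧ xs ∷ map (λ v → ⟦ v ⟧ xs) vs)
positive-differences⇒ascending xs u []       []       = [-]
positive-differences⇒ascending xs u (v ∷ vs) (g ∷ gs) =
  0<j-i⇒i<j (subst (0ℤ <_) (⟦⟧-⊖ v u xs) g) ∷ positive-differences⇒ascending xs v vs gs

-- For concrete us and σs the differences normalise to explicit forms, so only their positivity
-- at xs remains to be proved.
signedSumsetSize-certificate : (xs : Vec ℤ n) (us : Vec (Form n) k) (σs : List (SignVector h k)) →
  All (λ g → 0ℤ < ⟦ g ⟧ xs) (differences 𝟎 (map (λ σ → signedSum (formGroup n) σ us) σs)) →
  length σs ℕ.+ length σs ≤ signedSumsetSize h (toList (Vec.map (λ u → ⟦ u ⟧ xs) us))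
signedSumsetSize-certificate {n = n} xs us σs steps =
  positiveChain⇒signedSumsetSize≥ (Vec.map (λ u → ⟦ u ⟧ xs) us) σs
    (subst (Linked _<_) (cong₂ _∷_ (⟦⟧-𝟎 xs) values) (positive-differences⇒ascending xs 𝟎 _ steps))
  where
  values : map (λ v → ⟦ v ⟧ xs) (map (λ σ → signedSum (formGroup n) σ us) σs)
         ≡ map (λ σ → signedSumℤ σ (Vec.map (λ u → ⟦ u ⟧ xs) us)) σs
  values = trans (sym (map-∘ σs)) (map-cong (λ σ → ⟦⟧-signedSum σ us xs) σs)

-- Forms in the coordinates (a₁, a₂, a₃, a₅): the hypothesis a₄ − a₃ = a₂ − a₁ eliminates a₄.
α₁ α₂ α₃ α₄ α₅ δ ε φ : Form 4
α₁ = unit (# 0)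
α₂ = unit (# 1)
α₃ = unit (# 2)
α₅ = unit (# 3)
α₄ = α₂ ⊕ α₃ ⊖ α₁
δ  = α₂ ⊖ α₁
ε  = α₃ ⊖ α₂
φ  = α₅ ⊖ α₄

elementForms : Vec (Form 4) 5
elementForms = α₁ ∷ α₂ ∷ α₃ ∷ α₄ ∷ α₅ ∷ []

module Configuration (a₁ a₂ a₃ a₅ : ℤ) (0<a₁ : 0ℤ < a₁) (a₁<a₂ : a₁ < a₂) (a₂<a₃ : a₂ < a₃)
                     (a₄<a₅ : a₂ + a₃ - a₁ < a₅) where

  x : Vec ℤ 4
  x = a₁ ∷ a₂ ∷ a₃ ∷ a₅ ∷ []

  ⟦α₁⟧ : ⟦ α₁ ⟧ x ≡ a₁
  ⟦α₁⟧ = ⟦⟧-unit (# 0) x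

  ⟦α₂⟧ : ⟦ α₂ ⟧ x ≡ a₂
  ⟦α₂⟧ = ⟦⟧-unit (# 1) x

  ⟦α₃⟧ : ⟦ α₃ ⟧ x ≡ a₃
  ⟦α₃⟧ = ⟦⟧-unit (# 2) x

  ⟦α₅⟧ : ⟦ α₅ ⟧ x ≡ a₅
  ⟦α₅⟧ = ⟦⟧-unit (# 3) x

  ⟦α₄⟧ : ⟦ α₄ ⟧ x ≡ a₂ + a₃ - a₁
  ⟦α₄⟧ = trans (⟦⟧-⊖ (α₂ ⊕ α₃) α₁ x) (cong₂ _-_ (trans (⟦⟧-⊕ α₂ α₃ x) (cong₂ _+_ ⟦α₂⟧ ⟦α₃⟧)) ⟦α₁⟧)

  ⟦δ⟧ : ⟦ δ ⟧ x ≡ a₂ - a₁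
  ⟦δ⟧ = trans (⟦⟧-⊖ α₂ α₁ x) (cong₂ _-_ ⟦α₂⟧ ⟦α₁⟧)

  ⟦2α₁⟧ : ⟦ α₁ ⊕ α₁ ⟧ x ≡ + 2 * a₁
  ⟦2α₁⟧ = trans (⟦⟧-⊕ α₁ α₁ x) (trans (cong₂ _+_ ⟦α₁⟧ ⟦α₁⟧) (double a₁))
    where
    double : ∀ i → i + i ≡ + 2 * i
    double = solve-∀

  elements : Vec.map (λ u → ⟦ u ⟧ x) elementForms
           ≡ a₁ ∷ a₂ ∷ a₃ ∷ a₂ + a₃ - a₁ ∷ a₅ ∷ []
  elements = cong₂ _∷_ ⟦α₁⟧ (cong₂ _∷_ ⟦α₂⟧ (cong₂ _∷_ ⟦α₃⟧ (cong₂ _∷_ ⟦α₄⟧ (cong₂ _∷_ ⟦α₅⟧ refl))))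

  positive-gap : (u v : Form 4) {i j : ℤ} → ⟦ u ⟧ x ≡ i → ⟦ v ⟧ x ≡ j → i < j → 0ℤ < ⟦ v ⊖ u ⟧ x
  positive-gap u v ⟦u⟧ ⟦v⟧ i<j =
    subst (0ℤ <_) (sym (trans (⟦⟧-⊖ v u x) (cong₂ _-_ ⟦v⟧ ⟦u⟧))) (i<j⇒0<j-i i<j)

  0<δ : 0ℤ < ⟦ δ ⟧ x
  0<δ = positive-gap α₁ α₂ ⟦α₁⟧ ⟦α₂⟧ a₁<a₂

  0<ε : 0ℤ < ⟦ ε ⟧ x
  0<ε = positive-gap α₂ α₃ ⟦α₂⟧ ⟦α₃⟧ a₂<a₃

  0<φ : 0ℤ < ⟦ φ ⟧ x
  0<φ = positive-gap α₄ α₅ ⟦α₄⟧ ⟦α₅⟧ a₄<a₅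

  0<2α₁ : 0ℤ < ⟦ α₁ ⊕ α₁ ⟧ x
  0<2α₁ = subst (0ℤ <_) (sym (trans (⟦⟧-⊕ α₁ α₁ x) (cong₂ _+_ ⟦α₁⟧ ⟦α₁⟧))) (+-mono-< 0<a₁ 0<a₁)

  signedSumsetSize≥ : (σs : List (SignVector 4 5)) →
    All (λ g → 0ℤ < ⟦ g ⟧ x)
        (differences 𝟎 (map (λ σ → signedSum (formGroup 4) σ elementForms) σs)) →
    length σs ℕ.+ length σs ≤ signedSumsetSize 4 (a₁ ∷ a₂ ∷ a₃ ∷ a₂ + a₃ - a₁ ∷ a₅ ∷ [])
  signedSumsetSize≥ σs steps =
    subst (λ as → length σs ℕ.+ length σs ≤ signedSumsetSize 4 (toList as)) elements
      (signedSumsetSize-certificate x elementForms σs steps)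

  26≤signedSumsetSize-if-2a₁<d : + 2 * a₁ < a₂ - a₁ →
    26 ≤ signedSumsetSize 4 (a₁ ∷ a₂ ∷ a₃ ∷ a₂ + a₃ - a₁ ∷ a₅ ∷ [])
  26≤signedSumsetSize-if-2a₁<d 2a₁<d = signedSumsetSize≥
    ( (+∷ -∷ -∷ 0∷ +∷ [])
    ∷ (-∷ +∷ 0∷ -∷ +∷ [])
    ∷ (-∷ 0∷ +∷ -∷ +∷ [])
    ∷ (+∷ 0∷ +∷ -∷ +∷ [])
    ∷ (0∷ -∷ -∷ +∷ +∷ [])
    ∷ (-∷ -∷ +∷ 0∷ +∷ [])
    ∷ (+∷ -∷ +∷ 0∷ +∷ [])
    ∷ (-∷ -∷ 0∷ +∷ +∷ [])
    ∷ (+∷ -∷ 0∷ +∷ +∷ [])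
    ∷ (-∷ +∷ +∷ 0∷ +∷ [])
    ∷ (+∷ +∷ +∷ 0∷ +∷ [])
    ∷ (-∷ +∷ 0∷ +∷ +∷ [])
    ∷ (-∷ 0∷ +∷ +∷ +∷ [])
    ∷ [])
    (0<φ ∷ 0<δ ∷ 0<ε ∷ 0<2α₁ ∷ 0<δ-2α₁ ∷ 0<ε ∷ 0<2α₁ ∷ 0<δ-2α₁ ∷ 0<2α₁ ∷ 0<δ ∷ 0<2α₁ ∷ 0<δ-2α₁ ∷ 0<ε ∷ [])
    where
    0<δ-2α₁ : 0ℤ < ⟦ δ ⊖ (α₁ ⊕ α₁) ⟧ x
    0<δ-2α₁ = positive-gap (α₁ ⊕ α₁) δ ⟦2α₁⟧ ⟦δ⟧ 2a₁<d

  26≤signedSumsetSize-if-d<2a₁ : a₂ - a₁ < + 2 * a₁ →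
    26 ≤ signedSumsetSize 4 (a₁ ∷ a₂ ∷ a₃ ∷ a₂ + a₃ - a₁ ∷ a₅ ∷ [])
  26≤signedSumsetSize-if-d<2a₁ d<2a₁ = signedSumsetSize≥
    ( (+∷ -∷ -∷ 0∷ +∷ [])
    ∷ (-∷ +∷ 0∷ -∷ +∷ [])
    ∷ (-∷ 0∷ +∷ -∷ +∷ [])
    ∷ (0∷ -∷ -∷ +∷ +∷ [])
    ∷ (-∷ -∷ +∷ 0∷ +∷ [])
    ∷ (-∷ -∷ 0∷ +∷ +∷ [])
    ∷ (+∷ -∷ +∷ 0∷ +∷ [])
    ∷ (+∷ -∷ 0∷ +∷ +∷ [])
    ∷ (-∷ +∷ +∷ 0∷ +∷ [])
    ∷ (-∷ +∷ 0∷ +∷ +∷ [])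
    ∷ (+∷ +∷ +∷ 0∷ +∷ [])
    ∷ (+∷ +∷ 0∷ +∷ +∷ [])
    ∷ (+∷ 0∷ +∷ +∷ +∷ [])
    ∷ [])
    (0<φ ∷ 0<δ ∷ 0<ε ∷ 0<δ ∷ 0<ε ∷ 0<δ ∷ 0<2α₁-δ ∷ 0<δ ∷ 0<δ ∷ 0<δ ∷ 0<2α₁-δ ∷ 0<δ ∷ 0<ε ∷ [])
    where
    0<2α₁-δ : 0ℤ < ⟦ (α₁ ⊕ α₁) ⊖ δ ⟧ x
    0<2α₁-δ = positive-gap δ (α₁ ⊕ α₁) ⟦δ⟧ ⟦2α₁⟧ d<2a₁

-- Only the case a₂ − a₁ = 2a₁ has to be excluded.
lemma3p7 : (a₁ a₂ a₃ a₄ a₅ : ℤ) →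
    + 0 < a₁ → a₁ < a₂ → a₂ < a₃ → a₃ < a₄ → a₄ < a₅ →
    a₄ - a₃ ≡ a₂ - a₁ →
    a₅ - a₃ ≢ + 2 * a₁ →
    a₂ - a₁ ≢ + 2 * a₁ → a₃ - a₂ ≢ + 2 * a₁ →
    a₄ - a₃ ≢ + 2 * a₁ → a₅ - a₄ ≢ + 2 * a₁ →
    26 ≤ signedSumsetSize 4 (a₁ ∷ a₂ ∷ a₃ ∷ a₄ ∷ a₅ ∷ [])
lemma3p7 a₁ a₂ a₃ a₄ a₅ 0<a₁ a₁<a₂ a₂<a₃ _ a₄<a₅ equal-gaps _ d≢2a₁ _ _ _ =
  subst (λ t → 26 ≤ signedSumsetSize 4 (a₁ ∷ a₂ ∷ a₃ ∷ t ∷ a₅ ∷ [])) (sym a₄≡)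
    (by-cases (<-cmp (a₂ - a₁) (+ 2 * a₁)))
  where
  a₄≡ : a₄ ≡ a₂ + a₃ - a₁
  a₄≡ = trans (split a₃ a₄) (trans (cong (_+_ a₃) equal-gaps) (rearrange a₁ a₂ a₃))
    where
    split : ∀ i j → j ≡ i + (j - i)
    split = solve-∀
    rearrange : ∀ i j k → k + (j - i) ≡ j + k - i
    rearrange = solve-∀

  open Configuration a₁ a₂ a₃ a₅ 0<a₁ a₁<a₂ a₂<a₃ (subst (_< a₅) a₄≡ a₄<a₅)

  by-cases : Tri (a₂ - a₁ < + 2 * a₁) (a₂ - a₁ ≡ + 2 * a₁) (+ 2 * a₁ < a₂ - a₁) →
             26 ≤ signedSumsetSize 4 (a₁ ∷ a₂ ∷ a₃ ∷ a₂ + a₃ - a₁ ∷ a₅ ∷ [])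
  by-cases (tri< d<2a₁ _ _) = 26≤signedSumsetSize-if-d<2a₁ d<2a₁
  by-cases (tri≈ _ d≡2a₁ _) = ⊥-elim (d≢2a₁ d≡2a₁)
  by-cases (tri> _ _ 2a₁<d) = 26≤signedSumsetSize-if-2a₁<d 2a₁<d
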